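{- Let $M,N$ be terms of the extended stack calculus which both have a proper head normal form. If $M\not\sim N$, then $M$ and $N$ are separable.
   Context: The extended stack calculus. Stack variables $\alpha,\beta,\gamma,\ldots$. Stacks $\pi ::= \mathsf{nil}\mid\alpha\mid\mathsf{cdr}(\pi)\mid M::\pi$; terms $M ::= \mathsf{car}(\pi)\mid\mu\alpha.M\mid M\star\pi$ ($\star$ left-associative, precedence over $\mu$; $::$ right-associative, binding tighter than $\star$; $\mu\alpha_1\ldots\alpha_k.M\star\pi_1\star\cdots\star\pi_m$ abbreviates $\mu\alpha_1\ldots\mu\alpha_k.(M\star\pi_1\star\cdots\star\pi_m)$). $E\{\pi/\alpha\}$ is capture-avoiding substitution. Reductions: $(\mu\alpha.M)\star\pi\to M\{\pi/\alpha\}$, $\mathsf{car}(M::\pi)\to M$, $\mathsf{cdr}(M::\pi)\to\pi$; $=_s$ is the equivalence closure of their contextual closure. $\mathsf{cdr}^n$ is $n$-fold $\mathsf{cdr}$; $\mathsf{car}_n(\pi):=\mathsf{car}(\mathsf{cdr}^n(\pi))$. Canonical form: normal form w.r.t. the $\mathsf{car},\mathsf{cdr}$ rules. Head reduction: $M\to_h\mu\vec\alpha.N\{\varpi/\beta\}\star\vec\pi$ if $\mu\vec\alpha.(\mu\beta.N)\star\varpi\star\vec\pi$ is the canonical form of $M$ (no contextual closure). A hnf is a non-$\to_h$-reducible term $\mu\vec\alpha.H\star\vec\pi$, proper if $H=\mathsf{car}_n(\beta)$ and improper if $H=\mathsf{car}_n(\mathsf{nil})$; $\mathrm{hnf}(M)$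 is the hnf reached from $M$ by $\to_h$, if it exists; $M$ has a proper hnf if $\mathrm{hnf}(M)$ is defined and proper. Head contexts: $C[\cdot]::=[\cdot]\mid C[\cdot]\star\pi\mid\mu\alpha.C[\cdot]$. $\mathbf T:=\mu\alpha.\mathsf{car}_0(\alpha)\star\mathsf{cdr}^2(\alpha)$, $\mathbf F:=\mu\alpha.\mathsf{car}_1(\alpha)\star\mathsf{cdr}^2(\alpha)$; $M,N$ are separable if some head context $C$ has $C[M]=_s\mathbf T$ and $C[N]=_s\mathbf F$. Similarity of stacks $\sim_s$: the smallest equivalence relation on stacks containing $=_s$ such that (1) $\pi\sim_s M_1::\cdots::M_m::\mathsf{cdr}^k(\mathsf{nil})$ for every stack $\pi$, terms $M_i$ and $m,k\ge0$; (2) if $k-m=k'-m'$ then $M_1::\cdots::M_m::\mathsf{cdr}^k(\gamma)\sim_s N_1::\cdots::N_{m'}::\mathsf{cdr}^{k'}(\gamma)$. Similarity of terms $\sim$: the smallest equivalence relation on terms containing $=_s$ such that (1) if $k-m=k'-m'$, $\pi_i\sim_s\varpi_i$ for all $i=1,\ldots,\min\{m,m'\}$, and $\varpi_{\min\{m,m'\}+j}\sim_s\alpha_{\min\{k,k'\}+j}$ for all $j=1,\ldots,\max\{k,k'\}-\min\{k,k'\}$, then $\mu\alpha_1\ldots\alpha_k.\mathsf{car}_n(\beta)\star\pi_1\star\cdots\star\pi_m\sim\mu\alpha_1\ldots\alpha_{k'}.\mathsf{car}_n(\beta)\star\varpi_1\star\cdots\star\varpi_{m'}$; (2) if $\mathrm{hnf}(M)$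 and $\mathrm{hnf}(N)$ are both defined and improper then $M\sim N$; (3) if $\mathrm{hnf}(M)$ and $\mathrm{hnf}(N)$ are both undefined then $M\sim N$. -}

module Defs where

open import Data.Nat using (ℕ; zero; suc; _+_; _<_; _≤_; pred; _∸_)
open import Data.Nat.Properties using (<-cmp)
open import Data.List using (List; []; _∷_; _++_; length; map; reverse; upTo)
open import Data.List.Relation.Binary.Pointwise using (Pointwise)
open import Data.Product using (Σ; ∃; _×_; _,_)
open import Data.Empty using (⊥)
open import Relation.Nullary using (¬_)
open import Relation.Binary.Core using (Rel)
open import Relation.Binary.Definitions using (tri<; tri≈; tri>)
open import Relation.Binary.PropositionalEquality using (_≡_)
open import Relation.Binary.Construct.Closure.ReflexiveTransitive using (Star)
open import Relation.Binary.Construct.Closure.Equivalence using (EqClosure)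

-- Syntax of the extended stack calculus (de Bruijn indices for stack
-- variables; `μ` binds index 0 in its body).

data Sort : Set where
  tm st : Sort

infixr 6 _∷ₛ_
infixl 5 _⋆_

data Exp : Sort → Set where
  nil   : Exp st
  var   : ℕ → Exp st
  cdr   : Exp st → Exp st
  _∷ₛ_  : Exp tm → Exp st → Exp st
  car   : Exp st → Exp tm
  μ     : Exp tm → Exp tm
  _⋆_   : Exp tm → Exp st → Exp tm

Term Stack : Set
Term  = Exp tm
Stack = Exp st

shift : ∀ {s} → ℕ → Exp s → Exp s
shift c nil = nil
shift c (var i) with <-cmp i c
... | tri< _ _ _ = var i
... | tri≈ _ _ _ = var (suc i)
... | tri> _ _ _ = var (suc i)
shift c (cdr π) = cdr (shift c π)
shift c (M ∷ₛ π) = shift c M ∷ₛ shift c π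
shift c (car π) = car (shift c π)
shift c (μ M) = μ (shift (suc c) M)
shift c (M ⋆ π) = shift c M ⋆ shift c π

shiftN : ∀ {s} → ℕ → Exp s → Exp s
shiftN zero E = E
shiftN (suc d) E = shift 0 (shiftN d E)

subst : ∀ {s} → ℕ → Stack → Exp s → Exp s
subst j ρ nil = nil
subst j ρ (var i) with <-cmp i j
... | tri< _ _ _ = var i
... | tri≈ _ _ _ = ρ
... | tri> _ _ _ = var (pred i)
subst j ρ (cdr π) = cdr (subst j ρ π)
subst j ρ (M ∷ₛ π) = subst j ρ M ∷ₛ subst j ρ π
subst j ρ (car π) = car (subst j ρ π)
subst j ρ (μ M) = μ (subst (suc j) (shift 0 ρ) M)
subst j ρ (M ⋆ π) = subst j ρ M ⋆ subst j ρ π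

data BaseRule : ∀ {s} → Exp s → Exp s → Set where
  r-μ   : ∀ M π → BaseRule (μ M ⋆ π) (subst 0 π M)
  r-car : ∀ M π → BaseRule (car (M ∷ₛ π)) M
  r-cdr : ∀ M π → BaseRule (cdr (M ∷ₛ π)) π

data CarCdrRule : ∀ {s} → Exp s → Exp s → Set where
  r-car : ∀ M π → CarCdrRule (car (M ∷ₛ π)) M
  r-cdr : ∀ M π → CarCdrRule (cdr (M ∷ₛ π)) π

data Ctx (R : ∀ {s} → Exp s → Exp s → Set) : ∀ {s} → Exp s → Exp s → Set where
  c-base : ∀ {s} {E E' : Exp s} → R E E' → Ctx R E E'
  c-cdr  : ∀ {π π'} → Ctx R π π' → Ctx R (cdr π) (cdr π')
  c-∷ₛl  : ∀ {M M' π} → Ctx R M M' → Ctx R (M ∷ₛ π) (M' ∷ₛ π)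
  c-∷ₛr  : ∀ {M π π'} → Ctx R π π' → Ctx R (M ∷ₛ π) (M ∷ₛ π')
  c-car  : ∀ {π π'} → Ctx R π π' → Ctx R (car π) (car π')
  c-μ    : ∀ {M M'} → Ctx R M M' → Ctx R (μ M) (μ M')
  c-⋆l   : ∀ {M M' π} → Ctx R M M' → Ctx R (M ⋆ π) (M' ⋆ π)
  c-⋆r   : ∀ {M π π'} → Ctx R π π' → Ctx R (M ⋆ π) (M ⋆ π')

Step : ∀ {s} → Exp s → Exp s → Set
Step = Ctx BaseRule

infix 4 _=s_
_=s_ : ∀ {s} → Rel (Exp s) _
_=s_ = EqClosure Step

CCStep : ∀ {s} → Exp s → Exp s → Set
CCStep = Ctx CarCdrRule

Canonical : ∀ {s} → Exp s → Exp s → Set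
Canonical E N = Star CCStep E N × (∀ P → ¬ CCStep N P)

mus : ℕ → Term → Term
mus zero M = M
mus (suc k) M = μ (mus k M)

stars : Term → List Stack → Term
stars M [] = M
stars M (π ∷ πs) = stars (M ⋆ π) πs

cdrⁿ : ℕ → Stack → Stack
cdrⁿ zero π = π
cdrⁿ (suc n) π = cdr (cdrⁿ n π)

carₙ : ℕ → Stack → Term
carₙ n π = car (cdrⁿ n π)

data _→h_ (M : Term) : Term → Set where
  head : ∀ k N ϖ πs → Canonical M (mus k (stars (μ N ⋆ ϖ) πs))
       → M →h mus k (stars (subst 0 ϖ N) πs)

HeadNormal : Term → Set
HeadNormal M = ∀ M' → ¬ (M →h M')

IsProper : Term → Set
IsProper H = ∃ λ k → ∃ λ n → ∃ λ b → ∃ λ (πs : List Stack) →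
  H ≡ mus k (stars (carₙ n (var b)) πs)

IsImproper : Term → Set
IsImproper H = ∃ λ k → ∃ λ n → ∃ λ (πs : List Stack) →
  H ≡ mus k (stars (carₙ n nil) πs)

HnfOf : Term → Term → Set
HnfOf M H = ∃ λ M' → Star _→h_ M M' × Canonical M' H × HeadNormal H

HasProperHnf : Term → Set
HasProperHnf M = ∃ λ H → HnfOf M H × IsProper H

HasImproperHnf : Term → Set
HasImproperHnf M = ∃ λ H → HnfOf M H × IsImproper H

HnfUndefined : Term → Set
HnfUndefined M = ¬ (∃ λ H → HnfOf M H)

consList : List Term → Stack → Stack
consList [] π = π
consList (M ∷ Ms) π = M ∷ₛ consList Ms π

data SimSGen : Stack → Stack → Set where
  ss-eq  : ∀ {π π'} → π =s π' → SimSGen π π'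
  ss-nil : ∀ π Ms k → SimSGen π (consList Ms (cdrⁿ k nil))
  ss-var : ∀ Ms k Ns k' γ → k + length Ns ≡ k' + length Ms →
           SimSGen (consList Ms (cdrⁿ k (var γ))) (consList Ns (cdrⁿ k' (var γ)))

infix 4 _∼s_
_∼s_ : Rel Stack _
_∼s_ = EqClosure SimSGen

-- [α_{k+1}, …, α_{k+d}] as seen under k+d binders: [var (d-1), …, var 0]
etaVars : ℕ → List Stack
etaVars d = map var (reverse (upTo d))

data SimGen : Term → Term → Set where
  s-eq    : ∀ {M N} → M =s N → SimGen M N
  -- rule (1), with k ≤ k' = k + d (hence m' = m + d); the other
  -- orientation is obtained by symmetry
  s-hnf   : ∀ k d n b πs πs' ϖs →
            Pointwise (λ π π' → shiftN d π ∼s π') πs πs' →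
            Pointwise _∼s_ ϖs (etaVars d) →
            SimGen (mus k (stars (carₙ n (var b)) πs))
                   (mus (k + d) (stars (carₙ n (var (b + d))) (πs' ++ ϖs)))
  s-improper  : ∀ {M N} → HasImproperHnf M → HasImproperHnf N → SimGen M N
  s-undefined : ∀ {M N} → HnfUndefined M → HnfUndefined N → SimGen M N

infix 4 _∼_
_∼_ : Rel Term _
_∼_ = EqClosure SimGen

data HCtx : Set where
  hole : HCtx
  _⋆c_ : HCtx → Stack → HCtx
  μc   : HCtx → HCtx

plug : HCtx → Term → Term
plug hole M = M
plug (C ⋆c π) M = plug C M ⋆ π
plug (μc C) M = μ (plug C M)

𝐓 𝐅 : Term
𝐓 = μ (carₙ 0 (var 0) ⋆ cdrⁿ 2 (var 0))
𝐅 = μ (carₙ 1 (var 0) ⋆ cdrⁿ 2 (var 0))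

Separable : Term → Term → Set
Separable M N = ∃ λ C → (plug C M =s 𝐓) × (plug C N =s 𝐅)

module Submission where

-- As a term converts to its hnf, it suffices to separate two proper hnfs
-- HM = μ^k.car_n(b)⋆π₁⋯π_m and HN = μ^k'.car_n'(b')⋆π'₁⋯π'_m'.  The separating
-- context is μ^F.[·] ⋆ ξ₀ ⋯ ξ_{K+K'-1} ⋆ ws, with F = 1+b+b' binders binding both
-- head variables.  Feeding this spine to HM puts ξ_i at the head for a computable
-- position i (lemma select), leaving car_n(ξ_i) applied to a known number of stacks;
-- taking ξ_i to be a finite tuple of terms μ^t.𝐓, which absorb exactly t stacks
-- (lemma absorb), yields 𝐓, and likewise 𝐅 for HN.  This works whenever the
-- arities m+k' and m'+k differ (the longer spine reaches a trailing stack from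
-- which 𝐓 extracts 𝐅), the projections n, n' differ, or the head positions i, i'
-- differ.  Otherwise the hnfs are similar by rule (1) of ∼, as ∼s relates any two
-- stacks.

open import Defs
open import Data.Nat using (ℕ; zero; suc; _+_; _<_; _≤_; z≤n; s≤s; _≟_)
open import Data.Nat.Properties
open import Data.Nat.Tactic.RingSolver using (solve-∀)
open import Data.List using (List; []; _∷_; _++_; length; map; reverse; upTo; replicate; applyUpTo)
open import Data.List.Properties
  using (length-++; length-map; length-reverse; length-upTo; length-replicate; length-applyUpTo)
open import Data.List.Relation.Binary.Pointwise using (Pointwise; []; _∷_)
open import Data.Product using (∃; _×_; _,_)
open import Data.Sum using (inj₁; inj₂)
open import Data.Empty using (⊥-elim)
open import Relation.Nullary using (¬_; yes; no)
open import Relation.Binary.Definitions using (tri<; tri≈; tri>)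
open import Relation.Binary.PropositionalEquality
  using (_≡_; refl; sym; trans; cong; cong₂; module ≡-Reasoning) renaming (subst to transport)
open import Relation.Binary.Construct.Closure.ReflexiveTransitive using (Star; ε; _◅_; _◅◅_)
open import Relation.Binary.Construct.Closure.Symmetric using (fwd; bwd)
import Relation.Binary.Construct.Closure.Equivalence as EqClosure
import Relation.Binary.Reasoning.Setoid as SetoidReasoning

infixr 5 _∙_
_∙_ : ∀ {s} {E E' E'' : Exp s} → E =s E' → E' =s E'' → E =s E''
_∙_ = _◅◅_

≡⇒=s : ∀ {s} {E E' : Exp s} → E ≡ E' → E =s E'
≡⇒=s refl = ε

step : ∀ {s} {E E' : Exp s} → Step E E' → E =s E'
step p = fwd p ◅ ε

β : ∀ M π → μ M ⋆ π =s subst 0 π M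
β M π = step (c-base (r-μ M π))

module =s-Reasoning = SetoidReasoning (EqClosure.setoid (Step {tm}))

=s-map : ∀ {s s'} (f : Exp s → Exp s') → (∀ {E E'} → Step E E' → Step (f E) (f E')) →
         ∀ {E E'} → E =s E' → f E =s f E'
=s-map f f-step = EqClosure.gmap f f-step

stars-step : ∀ πs {M M'} → Step M M' → Step (stars M πs) (stars M' πs)
stars-step [] p = p
stars-step (π ∷ πs) p = stars-step πs (c-⋆l p)

mus-step : ∀ k {M M'} → Step M M' → Step (mus k M) (mus k M')
mus-step zero p = p
mus-step (suc k) p = c-μ (mus-step k p)

stars-cong : ∀ πs {M M'} → M =s M' → stars M πs =s stars M' πs
stars-cong πs = =s-map (λ M → stars M πs) (stars-step πs)

car-cong : ∀ {π π'} → π =s π' → car π =s car π'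
car-cong = =s-map car c-car

cdr-cong : ∀ {π π'} → π =s π' → cdr π =s cdr π'
cdr-cong = =s-map cdr c-cdr

stars-++ : ∀ M xs ys → stars M (xs ++ ys) ≡ stars (stars M xs) ys
stars-++ M [] ys = refl
stars-++ M (x ∷ xs) ys = stars-++ (M ⋆ x) xs ys

mus-+ : ∀ a c B → mus a (mus c B) ≡ mus (a + c) B
mus-+ zero c B = refl
mus-+ (suc a) c B = cong μ (mus-+ a c B)

data Cl : ∀ {s} → ℕ → Exp s → Set where
  cl-nil : ∀ {c} → Cl c nil
  cl-var : ∀ {c i} → i < c → Cl c (var i)
  cl-cdr : ∀ {c π} → Cl c π → Cl c (cdr π)
  cl-∷   : ∀ {c M π} → Cl c M → Cl c π → Cl c (M ∷ₛ π)
  cl-car : ∀ {c π} → Cl c π → Cl c (car π)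
  cl-μ   : ∀ {c M} → Cl (suc c) M → Cl c (μ M)
  cl-⋆   : ∀ {c M π} → Cl c M → Cl c π → Cl c (M ⋆ π)

Cl-weaken : ∀ {s c c'} {E : Exp s} → c ≤ c' → Cl c E → Cl c' E
Cl-weaken le cl-nil = cl-nil
Cl-weaken le (cl-var i<c) = cl-var (<-≤-trans i<c le)
Cl-weaken le (cl-cdr p) = cl-cdr (Cl-weaken le p)
Cl-weaken le (cl-∷ p q) = cl-∷ (Cl-weaken le p) (Cl-weaken le q)
Cl-weaken le (cl-car p) = cl-car (Cl-weaken le p)
Cl-weaken le (cl-μ p) = cl-μ (Cl-weaken (s≤s le) p)
Cl-weaken le (cl-⋆ p q) = cl-⋆ (Cl-weaken le p) (Cl-weaken le q)

Cl-mus : ∀ t {c} {B : Term} → Cl c B → Cl c (mus t B)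
Cl-mus zero p = p
Cl-mus (suc t) p = cl-μ (Cl-weaken (n≤1+n _) (Cl-mus t p))

shift-Cl : ∀ {s c c'} {E : Exp s} → Cl c E → c ≤ c' → shift c' E ≡ E
shift-Cl cl-nil le = refl
shift-Cl {c' = c'} (cl-var {i = i} i<c) le with <-cmp i c'
... | tri< _ _ _ = refl
... | tri≈ _ i≡c' _ = ⊥-elim (<-irrefl i≡c' (<-≤-trans i<c le))
... | tri> _ _ i>c' = ⊥-elim (<-asym i>c' (<-≤-trans i<c le))
shift-Cl (cl-cdr p) le = cong cdr (shift-Cl p le)
shift-Cl (cl-∷ p q) le = cong₂ _∷ₛ_ (shift-Cl p le) (shift-Cl q le)
shift-Cl (cl-car p) le = cong car (shift-Cl p le)
shift-Cl (cl-μ p) le = cong μ (shift-Cl p (s≤s le))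
shift-Cl (cl-⋆ p q) le = cong₂ _⋆_ (shift-Cl p le) (shift-Cl q le)

shiftN-Cl : ∀ {s} {E : Exp s} → Cl 0 E → ∀ K → shiftN K E ≡ E
shiftN-Cl p zero = refl
shiftN-Cl p (suc K) = trans (cong (shift 0) (shiftN-Cl p K)) (shift-Cl p z≤n)

subst-Cl : ∀ {s c j ρ} {E : Exp s} → Cl c E → c ≤ j → subst j ρ E ≡ E
subst-Cl cl-nil le = refl
subst-Cl {j = j} (cl-var {i = i} i<c) le with <-cmp i j
... | tri< _ _ _ = refl
... | tri≈ _ i≡j _ = ⊥-elim (<-irrefl i≡j (<-≤-trans i<c le))
... | tri> _ _ i>j = ⊥-elim (<-asym i>j (<-≤-trans i<c le))
subst-Cl (cl-cdr p) le = cong cdr (subst-Cl p le)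
subst-Cl (cl-∷ p q) le = cong₂ _∷ₛ_ (subst-Cl p le) (subst-Cl q le)
subst-Cl (cl-car p) le = cong car (subst-Cl p le)
subst-Cl (cl-μ p) le = cong μ (subst-Cl p (s≤s le))
subst-Cl (cl-⋆ p q) le = cong₂ _⋆_ (subst-Cl p le) (subst-Cl q le)

subst-var< : ∀ {b j ρ} → b < j → subst j ρ (var b) ≡ var b
subst-var< {b} {j} b<j with <-cmp b j
... | tri< _ _ _ = refl
... | tri≈ _ b≡j _ = ⊥-elim (<-irrefl b≡j b<j)
... | tri> _ _ b>j = ⊥-elim (<-asym b>j b<j)

subst-var-self : ∀ {j ρ} → subst j ρ (var j) ≡ ρ
subst-var-self {j} with <-cmp j j
... | tri< j<j _ _ = ⊥-elim (<-irrefl refl j<j)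
... | tri≈ _ _ _ = refl
... | tri> _ _ j>j = ⊥-elim (<-irrefl refl j>j)

shiftN-shift : ∀ {s} K (ρ : Exp s) → shiftN K (shift 0 ρ) ≡ shift 0 (shiftN K ρ)
shiftN-shift zero ρ = refl
shiftN-shift (suc K) ρ = cong (shift 0) (shiftN-shift K ρ)

subst-mus : ∀ K j ρ B → subst j ρ (mus K B) ≡ mus K (subst (K + j) (shiftN K ρ) B)
subst-mus zero j ρ B = refl
subst-mus (suc K) j ρ B = cong μ (trans (subst-mus K (suc j) (shift 0 ρ) B)
  (cong₂ (λ j' ρ' → mus K (subst j' ρ' B)) (+-suc K j) (shiftN-shift K ρ)))

subst-stars : ∀ j ρ M πs → subst j ρ (stars M πs) ≡ stars (subst j ρ M) (map (subst j ρ) πs)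
subst-stars j ρ M [] = refl
subst-stars j ρ M (π ∷ πs) = subst-stars j ρ (M ⋆ π) πs

subst-cdrⁿ : ∀ j ρ n π → subst j ρ (cdrⁿ n π) ≡ cdrⁿ n (subst j ρ π)
subst-cdrⁿ j ρ zero π = refl
subst-cdrⁿ j ρ (suc n) π = cong cdr (subst-cdrⁿ j ρ n π)

spine : ℕ → ℕ → Stack → List Stack → Term
spine k n h πs = mus k (stars (carₙ n h) πs)

record HeadForm (E : Term) (n : ℕ) (h : Stack) (l : ℕ) : Set where
  constructor headForm
  field
    args  : List Stack
    arity : length args ≡ l
    conv  : E =s stars (carₙ n h) args

HeadForm-conv : ∀ {E E' n h l} → E =s E' → HeadForm E' n h l → HeadForm E n h l
HeadForm-conv E=E' (headForm πs len E'=H) = headForm πs len (E=E' ∙ E'=H)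

HeadForm-arity : ∀ {E n h l l'} → l ≡ l' → HeadForm E n h l → HeadForm E n h l'
HeadForm-arity refl hf = hf

β-spine : ∀ r n h πs x {h'} → subst r (shiftN r x) h ≡ h' →
          spine (suc r) n h πs ⋆ x =s spine r n h' (map (subst r (shiftN r x)) πs)
β-spine r n h πs x refl = begin
  μ (mus r B) ⋆ x                          ≈⟨ β (mus r B) x ⟩
  subst 0 x (mus r B)                      ≡⟨ subst-mus r 0 x B ⟩
  mus r (subst (r + 0) (shiftN r x) B)     ≡⟨ cong (λ j → mus r (subst j (shiftN r x) B)) (+-identityʳ r) ⟩
  mus r (σ B)                              ≡⟨ cong (mus r) (subst-stars r (shiftN r x) (carₙ n h) πs) ⟩
  mus r (stars (car (σ (cdrⁿ n h))) (map σ πs))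
                                           ≡⟨ cong (λ π → mus r (stars (car π) (map σ πs))) (subst-cdrⁿ r (shiftN r x) n h) ⟩
  spine r n (σ h) (map σ πs)               ∎
  where
  open =s-Reasoning
  σ : ∀ {s} → Exp s → Exp s
  σ = subst r (shiftN r x)
  B : Term
  B = stars (carₙ n h) πs

consume-closed : ∀ r n {h} πs xs {e} → Cl 0 h → length xs ≡ r + e →
                 HeadForm (stars (spine r n h πs) xs) n h (length πs + e)
consume-closed zero n πs xs cl refl =
  headForm (πs ++ xs) (length-++ πs) (≡⇒=s (sym (stars-++ (carₙ n _) πs xs)))
consume-closed (suc r) n πs (x ∷ xs) cl len =
  HeadForm-conv (stars-cong xs (β-spine r n _ πs x (subst-Cl cl z≤n)))
    (HeadForm-arity (cong (_+ _) (length-map σ πs))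
      (consume-closed r n (map σ πs) xs cl (suc-injective len)))
  where
  σ : Stack → Stack
  σ = subst r (shiftN r x)

-- the head variable b of a spine under j+b+1 binders is bound by binder number j,
-- so it is replaced by the j-th stack fed to the spine (when that stack is closed)
select-var : ∀ {j} b n πs ys {x} zs {e} → length ys ≡ j → Cl 0 x → length zs ≡ b + e →
             HeadForm (stars (spine (suc (j + b)) n (var b) πs) (ys ++ x ∷ zs)) n x (length πs + e)
select-var b n πs [] {x} zs refl cl len =
  HeadForm-conv (stars-cong zs (β-spine b n (var b) πs x (trans subst-var-self (shiftN-Cl cl b))))
    (HeadForm-arity (cong (_+ _) (length-map σ πs))
      (consume-closed b n (map σ πs) zs cl len))
  where
  σ : Stack → Stack
  σ = subst b (shiftN b x)
select-var b n πs (y ∷ ys) zs refl cl len =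
  HeadForm-conv (stars-cong (ys ++ _ ∷ zs) (β-spine r n (var b) πs y (subst-var< (s≤s (m≤n+m b _)))))
    (HeadForm-arity (cong (_+ _) (length-map σ πs))
      (select-var b n (map σ πs) ys zs refl cl len))
  where
  r : ℕ
  r = suc (length ys + b)
  σ : Stack → Stack
  σ = subst r (shiftN r y)

applyUpTo-split : ∀ (g : ℕ → Stack) i c →
                  applyUpTo g (i + suc c) ≡ applyUpTo g i ++ g i ∷ applyUpTo (λ j → g (suc i + j)) c
applyUpTo-split g zero c = refl
applyUpTo-split g (suc i) c = cong (g 0 ∷_) (applyUpTo-split (λ j → g (suc j)) i c)

-- Feeding ξ₀,ξ₁,… to the proper hnf μ^F μ^k.car_n(b)⋯ puts ξ_i at the head, where
-- F + k = i + b + 1 (binder number i binds the head variable)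
select : ∀ F k n b πs i (ξ : ℕ → Stack) e → F + k ≡ suc (i + b) → Cl 0 (ξ i) →
         HeadForm (stars (mus F (spine k n (var b) πs)) (applyUpTo ξ (F + k + e))) n (ξ i) (length πs + e)
select F k n b πs i ξ e binders cl =
  HeadForm-conv (≡⇒=s (cong₂ stars term-eq spine-eq))
    (select-var b n πs (applyUpTo ξ i) (applyUpTo _ (b + e))
      (length-applyUpTo ξ i) cl (length-applyUpTo _ (b + e)))
  where
  term-eq : mus F (spine k n (var b) πs) ≡ spine (suc (i + b)) n (var b) πs
  term-eq = trans (mus-+ F k _) (cong (λ K → spine K n (var b) πs) binders)
  count : F + k + e ≡ i + suc (b + e)
  count = trans (cong (_+ e) binders) (arith i b e)
    where arith : ∀ x y z → suc (x + y) + z ≡ x + suc (y + z)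
          arith = solve-∀
  spine-eq : applyUpTo ξ (F + k + e) ≡ applyUpTo ξ i ++ ξ i ∷ applyUpTo _ (b + e)
  spine-eq = trans (cong (applyUpTo ξ) count) (applyUpTo-split ξ i (b + e))

tuple : (ℕ → Term) → ℕ → Stack
tuple f r = consList (applyUpTo f r) nil

cdr-∷ : ∀ j x π → cdrⁿ (suc j) (x ∷ₛ π) =s cdrⁿ j π
cdr-∷ zero x π = step (c-base (r-cdr x π))
cdr-∷ (suc j) x π = cdr-cong (cdr-∷ j x π)

carₙ-tuple : ∀ f {j r} → j < r → carₙ j (tuple f r) =s f j
carₙ-tuple f {zero} {suc r} _ = step (c-base (r-car (f 0) _))
carₙ-tuple f {suc j} {suc r} (s≤s j<r) =
  car-cong (cdr-∷ j (f 0) _) ∙ carₙ-tuple (λ x → f (suc x)) j<r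

Cl-tuple : ∀ f r → (∀ j → Cl 0 (f j)) → Cl 0 (tuple f r)
Cl-tuple f zero cl = cl-nil
Cl-tuple f (suc r) cl = cl-∷ (cl 0) (Cl-tuple (λ j → f (suc j)) r (λ j → cl (suc j)))

pick : {A : Set} → ℕ → A → A → ℕ → A
pick i x y j with j ≟ i
... | yes _ = x
... | no _ = y

pick-here : ∀ {A : Set} i (x y : A) → pick i x y i ≡ x
pick-here i x y with i ≟ i
... | yes _ = refl
... | no i≢i = ⊥-elim (i≢i refl)

pick-elsewhere : ∀ {A : Set} i (x y : A) {j} → ¬ j ≡ i → pick i x y j ≡ y
pick-elsewhere i x y {j} j≢i with j ≟ i
... | yes j≡i = ⊥-elim (j≢i j≡i)
... | no _ = refl

pick-preserves : ∀ {A : Set} (P : A → Set) i {x y} → P x → P y → ∀ j → P (pick i x y j)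
pick-preserves P i px py j with j ≟ i
... | yes _ = px
... | no _ = py

absorb : ∀ xs {t} {B : Term} → Cl 0 B → length xs ≡ t → stars (mus t B) xs =s B
absorb [] cl refl = ε
absorb (x ∷ xs) cl refl =
  stars-cong xs (β _ x ∙ ≡⇒=s (subst-Cl (Cl-mus (length xs) cl) z≤n)) ∙ absorb xs cl refl

absorb-prefix : ∀ pre ws {t} {B : Term} → Cl 0 B → length pre ≡ t →
                stars (mus t B) (pre ++ ws) =s stars B ws
absorb-prefix pre ws cl len =
  ≡⇒=s (stars-++ _ pre ws) ∙ stars-cong ws (absorb pre cl len)

Cl-𝐓 : Cl 0 𝐓
Cl-𝐓 = cl-μ (cl-⋆ (cl-car (cl-var (s≤s z≤n))) (cl-cdr (cl-cdr (cl-var (s≤s z≤n)))))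

Cl-𝐅 : Cl 0 𝐅
Cl-𝐅 = cl-μ (cl-⋆ (cl-car (cl-cdr (cl-var (s≤s z≤n)))) (cl-cdr (cl-cdr (cl-var (s≤s z≤n)))))

𝐓-first : ∀ X Y ρ → 𝐓 ⋆ (X ∷ₛ Y ∷ₛ ρ) =s X ⋆ ρ
𝐓-first X Y ρ =
  β _ _ ∙ step (c-⋆l (c-base (r-car X _))) ∙ step (c-⋆r (c-cdr (c-base (r-cdr X _))))
        ∙ step (c-⋆r (c-base (r-cdr Y ρ)))

𝐅-second : ∀ X Y ρ → 𝐅 ⋆ (X ∷ₛ Y ∷ₛ ρ) =s Y ⋆ ρ
𝐅-second X Y ρ =
  β _ _ ∙ car-⋆ (cdr-∷ 0 X _) ∙ step (c-⋆l (c-base (r-car Y ρ)))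
        ∙ step (c-⋆r (c-cdr (c-base (r-cdr X _)))) ∙ step (c-⋆r (c-base (r-cdr Y ρ)))
  where
  car-⋆ : ∀ {π π'} {ρ' : Stack} → π =s π' → car π ⋆ ρ' =s car π' ⋆ ρ'
  car-⋆ {ρ' = ρ'} = =s-map (λ π → car π ⋆ ρ') (λ p → c-⋆l (c-car p))

abstractCtx : ℕ → HCtx
abstractCtx zero = hole
abstractCtx (suc F) = μc (abstractCtx F)

applyCtx : HCtx → List Stack → HCtx
applyCtx C [] = C
applyCtx C (x ∷ xs) = applyCtx (C ⋆c x) xs

plug-abstractCtx : ∀ F M → plug (abstractCtx F) M ≡ mus F M
plug-abstractCtx zero M = refl
plug-abstractCtx (suc F) M = cong μ (plug-abstractCtx F M)

plug-applyCtx : ∀ C xs M → plug (applyCtx C xs) M ≡ stars (plug C M) xs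
plug-applyCtx C [] M = refl
plug-applyCtx C (x ∷ xs) M = plug-applyCtx (C ⋆c x) xs M

plug-cong : ∀ C {M M'} → M =s M' → plug C M =s plug C M'
plug-cong C = =s-map (plug C) (plug-step C)
  where
  plug-step : ∀ C {M M'} → Step M M' → Step (plug C M) (plug C M')
  plug-step hole p = p
  plug-step (C ⋆c π) p = c-⋆l (plug-step C p)
  plug-step (μc C) p = c-μ (plug-step C p)

-- feeding  μ𝐅 :: μ𝐓 :: nil  exchanges 𝐓 and 𝐅, so separability is symmetric
separable-sym : ∀ {M N} → Separable M N → Separable N M
separable-sym {M} {N} (C , M=𝐓 , N=𝐅) = C ⋆c swap , N-side , M-side
  where
  swap : Stack
  swap = μ 𝐅 ∷ₛ μ 𝐓 ∷ₛ nil
  N-side : plug C N ⋆ swap =s 𝐓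
  N-side = =s-map (_⋆ swap) c-⋆l N=𝐅 ∙ 𝐅-second _ _ nil ∙ absorb (nil ∷ []) Cl-𝐓 refl
  M-side : plug C M ⋆ swap =s 𝐅
  M-side = =s-map (_⋆ swap) c-⋆l M=𝐓 ∙ 𝐓-first _ _ nil ∙ absorb (nil ∷ []) Cl-𝐅 refl

separable-resp-=s : ∀ {M M' N N'} → M =s M' → N =s N' → Separable M' N' → Separable M N
separable-resp-=s M=M' N=N' (C , M'=𝐓 , N'=𝐅) =
  C , plug-cong C M=M' ∙ M'=𝐓 , plug-cong C N=N' ∙ N'=𝐅

Star⇒=s : ∀ {R : Term → Term → Set} → (∀ {M M'} → R M M' → M =s M') →
          ∀ {M M'} → Star R M M' → M =s M'
Star⇒=s f ε = ε
Star⇒=s f (p ◅ ps) = f p ∙ Star⇒=s f ps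

carcdr⇒step : ∀ {s} {E E' : Exp s} → CCStep E E' → Step E E'
carcdr⇒step (c-base (r-car M π)) = c-base (r-car M π)
carcdr⇒step (c-base (r-cdr M π)) = c-base (r-cdr M π)
carcdr⇒step (c-cdr p) = c-cdr (carcdr⇒step p)
carcdr⇒step (c-∷ₛl p) = c-∷ₛl (carcdr⇒step p)
carcdr⇒step (c-∷ₛr p) = c-∷ₛr (carcdr⇒step p)
carcdr⇒step (c-car p) = c-car (carcdr⇒step p)
carcdr⇒step (c-μ p) = c-μ (carcdr⇒step p)
carcdr⇒step (c-⋆l p) = c-⋆l (carcdr⇒step p)
carcdr⇒step (c-⋆r p) = c-⋆r (carcdr⇒step p)

head-step⇒=s : ∀ {M M'} → M →h M' → M =s M'
head-step⇒=s (head k N ϖ πs (canon , _)) =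
  Star⇒=s (λ p → step (carcdr⇒step p)) canon ∙ step (mus-step k (stars-step πs (c-base (r-μ N ϖ))))

hnf-conv : ∀ {M H} → HnfOf M H → M =s H
hnf-conv (_ , heads , (canon , _) , _) =
  Star⇒=s head-step⇒=s heads ∙ Star⇒=s (λ p → step (carcdr⇒step p)) canon

=s⇒∼ : ∀ {M N} → M =s N → M ∼ N
=s⇒∼ M=N = EqClosure.return (s-eq M=N)

-- rule (1) of ∼s relates every stack to nil, so any two stacks are similar
∼s-total : ∀ π π' → π ∼s π'
∼s-total π π' = fwd (ss-nil π [] 0) ◅ bwd (ss-nil π' [] 0) ◅ ε

Pointwise-total : {R : Stack → Stack → Set} → (∀ x y → R x y) →
                  ∀ xs ys → length xs ≡ length ys → Pointwise R xs ys
Pointwise-total R-total [] [] _ = []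
Pointwise-total R-total (x ∷ xs) (y ∷ ys) len =
  R-total x y ∷ Pointwise-total R-total xs ys (suc-injective len)

split-at-length : ∀ {A : Set} a {c} (xs : List A) → length xs ≡ a + c →
                  ∃ λ ys → ∃ λ zs → xs ≡ ys ++ zs × length ys ≡ a × length zs ≡ c
split-at-length zero xs len = [] , xs , refl , refl , len
split-at-length (suc a) (x ∷ xs) len with split-at-length a xs (suc-injective len)
... | ys , zs , refl , len-ys , len-zs = x ∷ ys , zs , refl , cong suc len-ys , len-zs

similar-padded : ∀ k d n b πs πs' → length πs' ≡ length πs + d →
                 spine k n (var b) πs ∼ spine (k + d) n (var (b + d)) πs'
similar-padded k d n b πs πs' len with split-at-length (length πs) πs' len
... | ys , zs , refl , len-ys , len-zs =
  EqClosure.return (s-hnf k d n b πs ys zs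
    (Pointwise-total (λ π π' → ∼s-total (shiftN d π) π') πs ys (sym len-ys))
    (Pointwise-total ∼s-total zs (etaVars d) (trans len-zs (sym length-etaVars))))
  where
  length-etaVars : length (etaVars d) ≡ d
  length-etaVars = trans (length-map var (reverse (upTo d))) (trans (length-reverse (upTo d)) (length-upTo d))

swap-inner : ∀ x y z → x + (y + z) ≡ x + z + y
swap-inner = solve-∀

-- the case k ≤ k': HN is HM η-expanded by d = k' - k binders
similar-ordered : ∀ k k' n b b' πs πs' → k ≤ k' → b' + k ≡ b + k' →
                  length πs + k' ≡ length πs' + k → spine k n (var b) πs ∼ spine k' n (var b') πs'
similar-ordered k k' n b b' πs πs' k≤k' heads arities with m≤n⇒∃[o]m+o≡n k≤k'
... | d , refl =
  transport (λ c → spine k n (var b) πs ∼ spine (k + d) n (var c) πs') (sym b'≡b+d)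
    (similar-padded k d n b πs πs' lengths)
  where
  b'≡b+d : b' ≡ b + d
  b'≡b+d = +-cancelʳ-≡ k b' (b + d) (trans heads (swap-inner b k d))
  lengths : length πs' ≡ length πs + d
  lengths = +-cancelʳ-≡ k (length πs') (length πs + d) (trans (sym arities) (swap-inner _ k d))

similar-spines : ∀ k k' n b b' πs πs' → b' + k ≡ b + k' →
                 length πs + k' ≡ length πs' + k → spine k n (var b) πs ∼ spine k' n (var b') πs'
similar-spines k k' n b b' πs πs' heads arities with ≤-total k k'
... | inj₁ k≤k' = similar-ordered k k' n b b' πs πs' k≤k' heads arities
... | inj₂ k'≤k = EqClosure.symmetric SimGen
  (similar-ordered k' k n b' b πs' πs k'≤k (sym heads) (sym arities))

Yields : Term → ℕ → List Stack → Term → Set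
Yields H l ws R = ∀ pre → length pre ≡ l → stars H (pre ++ ws) =s R

yields-from-head : ∀ {E n h l A ws R} → HeadForm E n h l → carₙ n h =s A → Yields A l ws R →
                   stars E ws =s R
yields-from-head {A = A} {ws} (headForm pre len E=H) head=A yields =
  stars-cong ws (E=H ∙ stars-cong pre head=A) ∙ ≡⇒=s (sym (stars-++ A pre ws)) ∙ yields pre len

yields-absorb : ∀ l {B} → Cl 0 B → Yields (mus l B) l [] B
yields-absorb l cl pre len = absorb-prefix pre [] cl len

module Separation (k n b : ℕ) (πs : List Stack) (k' n' b' : ℕ) (πs' : List Stack) where

  HM HN : Term
  HM = spine k n (var b) πs
  HN = spine k' n' (var b') πs'

  -- F extra binders bind both head variables; i, i' are the positions of their binders
  F i i' uM uN : ℕ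
  F = suc (b + b')
  i = b' + k
  i' = b + k'
  -- the number of stacks the heads of HM, HN receive from the spine ξ₀ ⋯ ξ_{K+K'-1},
  -- where K = F + k and K' = F + k' are the numbers of binders in μ^F.HM, μ^F.HN
  uM = length πs + (F + k')
  uN = length πs' + (F + k)

  separate-by : (ξ : ℕ → Stack) (ws : List Stack) {AM AN : Term} → Cl 0 (ξ i) → Cl 0 (ξ i') →
                carₙ n (ξ i) =s AM → carₙ n' (ξ i') =s AN →
                Yields AM uM ws 𝐓 → Yields AN uN ws 𝐅 → Separable HM HN
  separate-by ξ ws clM clN headM headN yieldsM yieldsN = C , M-side , N-side
    where
    C : HCtx
    C = applyCtx (abstractCtx F) (applyUpTo ξ (F + k + (F + k')) ++ ws)
    -- C[H] is μ^F.H fed the spine ξ₀ ⋯ ξ_{K-1}, then ws (K is the length, written either way)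
    plug-C : ∀ H K → K ≡ F + k + (F + k') → plug C H ≡ stars (stars (mus F H) (applyUpTo ξ K)) ws
    plug-C H K refl = begin
      plug C H                                  ≡⟨ plug-applyCtx (abstractCtx F) (applyUpTo ξ K ++ ws) H ⟩
      stars (plug (abstractCtx F) H) (applyUpTo ξ K ++ ws)
                                                ≡⟨ cong (λ M → stars M (applyUpTo ξ K ++ ws)) (plug-abstractCtx F H) ⟩
      stars (mus F H) (applyUpTo ξ K ++ ws)     ≡⟨ stars-++ (mus F H) (applyUpTo ξ K) ws ⟩
      stars (stars (mus F H) (applyUpTo ξ K)) ws ∎
      where open ≡-Reasoning
    M-side : plug C HM =s 𝐓
    M-side = ≡⇒=s (plug-C HM _ refl) ∙
      yields-from-head (select F k n b πs i ξ (F + k') (arith b b' k) clM) headM yieldsM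
      where arith : ∀ x y z → suc (x + y) + z ≡ suc (y + z + x)
            arith = solve-∀
    N-side : plug C HN =s 𝐅
    N-side = ≡⇒=s (plug-C HN _ (+-comm (F + k') (F + k))) ∙
      yields-from-head (select F k' n' b' πs' i' ξ (F + k) (arith b b' k') clN) headN yieldsN
      where arith : ∀ x y z → suc (x + y) + z ≡ suc (x + z + y)
            arith = solve-∀

  -- different head positions: the two heads receive different tuples
  heads-differ : ¬ i ≡ i' → Separable HM HN
  heads-differ i≢i' =
    separate-by ξ [] (Cl-ξ i) (Cl-ξ i') headM headN (yields-absorb uM Cl-𝐓) (yields-absorb uN Cl-𝐅)
    where
    TM TN : Stack
    TM = tuple (λ _ → mus uM 𝐓) (suc n)
    TN = tuple (λ _ → mus uN 𝐅) (suc n')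
    ξ : ℕ → Stack
    ξ = pick i TM TN
    Cl-ξ : ∀ j → Cl 0 (ξ j)
    Cl-ξ = pick-preserves (Cl 0) i (Cl-tuple _ (suc n) (λ _ → Cl-mus uM Cl-𝐓))
                                   (Cl-tuple _ (suc n') (λ _ → Cl-mus uN Cl-𝐅))
    headM : carₙ n (ξ i) =s mus uM 𝐓
    headM = ≡⇒=s (cong (carₙ n) (pick-here i TM TN)) ∙ carₙ-tuple (λ _ → mus uM 𝐓) ≤-refl
    headN : carₙ n' (ξ i') =s mus uN 𝐅
    headN = ≡⇒=s (cong (carₙ n') (pick-elsewhere i TM TN (λ i'≡i → i≢i' (sym i'≡i))))
          ∙ carₙ-tuple (λ _ → mus uN 𝐅) ≤-refl

  -- different projections: one tuple whose n-th and n'-th components differ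
  projections-differ : ¬ n ≡ n' → Separable HM HN
  projections-differ n≢n' =
    separate-by (λ _ → T) [] Cl-T Cl-T headM headN (yields-absorb uM Cl-𝐓) (yields-absorb uN Cl-𝐅)
    where
    f : ℕ → Term
    f = pick n (mus uM 𝐓) (mus uN 𝐅)
    T : Stack
    T = tuple f (suc (n + n'))
    Cl-T : Cl 0 T
    Cl-T = Cl-tuple f _ (pick-preserves (Cl 0) n (Cl-mus uM Cl-𝐓) (Cl-mus uN Cl-𝐅))
    headM : carₙ n T =s mus uM 𝐓
    headM = carₙ-tuple f (s≤s (m≤m+n n n')) ∙ ≡⇒=s (pick-here n _ _)
    headN : carₙ n' T =s mus uN 𝐅
    headN = carₙ-tuple f (s≤s (m≤n+m n' n)) ∙ ≡⇒=s (pick-elsewhere n _ _ (λ n'≡n → n≢n' (sym n'≡n)))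

  -- HM receives fewer stacks than HN: μ^uN.𝐓 turns HM into 𝐓, while HN has its
  -- stack P left over, from which 𝐓 extracts a term reducing to 𝐅
  arities-differ : length πs + k' < length πs' + k → Separable HM HN
  arities-differ shorter with m≤n⇒∃[o]m+o≡n shorter
  ... | d , excess = separate-by (λ _ → T) ws Cl-T Cl-T headM headN yieldsM yieldsN
    where
    f : ℕ → Term
    f _ = mus uN 𝐓
    T : Stack
    T = tuple f (suc (n + n'))
    Cl-T : Cl 0 T
    Cl-T = Cl-tuple f _ (λ _ → Cl-mus uN Cl-𝐓)
    headM : carₙ n T =s mus uN 𝐓
    headM = carₙ-tuple f (s≤s (m≤m+n n n'))
    headN : carₙ n' T =s mus uN 𝐓
    headN = carₙ-tuple f (s≤s (m≤n+m n' n))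
    ws : List Stack
    ws = (mus (suc d) 𝐅 ∷ₛ 𝐅 ∷ₛ nil) ∷ replicate d nil
    length-ws : length ws ≡ suc d
    length-ws = cong suc (length-replicate d)
    uM+ws : uM + suc d ≡ uN
    uM+ws = begin
      length πs + (F + k') + suc d    ≡⟨ arith (length πs) F k' d ⟩
      F + (suc (length πs + k') + d)  ≡⟨ cong (F +_) excess ⟩
      F + (length πs' + k)            ≡⟨ arith' F (length πs') k ⟩
      uN                              ∎
      where
      open ≡-Reasoning
      arith : ∀ a x c y → a + (x + c) + suc y ≡ x + (suc (a + c) + y)
      arith = solve-∀
      arith' : ∀ x a c → x + (a + c) ≡ a + (x + c)
      arith' = solve-∀
    yieldsM : Yields (mus uN 𝐓) uM ws 𝐓
    yieldsM pre len =
      absorb (pre ++ ws) Cl-𝐓 (trans (length-++ pre) (trans (cong₂ _+_ len length-ws) uM+ws))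
    yieldsN : Yields (mus uN 𝐓) uN ws 𝐅
    yieldsN pre len =
      absorb-prefix pre ws Cl-𝐓 len ∙ stars-cong (replicate d nil) (𝐓-first _ 𝐅 nil)
      ∙ absorb (nil ∷ replicate d nil) Cl-𝐅 length-ws

separate-proper : ∀ k n b πs k' n' b' πs' → ¬ spine k n (var b) πs ∼ spine k' n' (var b') πs' →
                  Separable (spine k n (var b) πs) (spine k' n' (var b') πs')
separate-proper k n b πs k' n' b' πs' HM≁HN with <-cmp (length πs + k') (length πs' + k)
... | tri< shorter _ _ = Separation.arities-differ k n b πs k' n' b' πs' shorter
... | tri> _ _ longer = separable-sym (Separation.arities-differ k' n' b' πs' k n b πs longer)
... | tri≈ _ arities _ with n ≟ n'
...   | no n≢n' = Separation.projections-differ k n b πs k' n' b' πs' n≢n'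
...   | yes refl with b' + k ≟ b + k'
...     | no i≢i' = Separation.heads-differ k n b πs k' n' b' πs' i≢i'
...     | yes heads = ⊥-elim (HM≁HN (similar-spines k k' n b b' πs πs' heads arities))

theorem8 : (M N : Term) → HasProperHnf M → HasProperHnf N → ¬ (M ∼ N) → Separable M N
theorem8 M N (_ , M⇒HM , k , n , b , πs , refl) (_ , N⇒HN , k' , n' , b' , πs' , refl) M≁N =
  separable-resp-=s M=HM N=HN (separate-proper k n b πs k' n' b' πs' HM≁HN)
  where
  M=HM : M =s spine k n (var b) πs
  M=HM = hnf-conv M⇒HM
  N=HN : N =s spine k' n' (var b') πs'
  N=HN = hnf-conv N⇒HN
  HM≁HN : ¬ spine k n (var b) πs ∼ spine k' n' (var b') πs'
  HM≁HN HM∼HN = M≁N (=s⇒∼ M=HM ◅◅ HM∼HN ◅◅ EqClosure.symmetric SimGen (=s⇒∼ N=HN))
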